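{- Let $n$ be a positive integer. For all non-negative integers $j$ and $\ell$ with $2j\le n-\ell$, we have $(j+1)C_\ell\in\mathcal{R}(n,1)$.
   Context: $C_i=\frac{1}{i+1}\binom{2i}{i}$ is the $i$-th Catalan number. Consider words over the alphabet $\{A,\overline{A}\}$, where $A$ and $\overline{A}$ are complements. A plane tree is a rooted tree embedded in the plane with root on top, children ordered left to right; its half edges are ordered by starting at the root and tracing the perimeter counterclockwise, touching each side of each edge once. For a word $w=w[1]\cdots w[2n]$ and plane tree $T$ with $n$ edges, label the $i$-th half edge by $w[i]$; $T$ is $w$-valid if the two labels of every edge are complements. $\mathcal{R}(n,1)$ is the set of integers $k\ge 0$ such that some word of length $2n$ over $\{A,\overline{A}\}$ has exactly $k$ valid plane trees. -}

module Defs where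

open import Data.Nat using (ℕ; zero; suc; _+_; _*_; _/_)
open import Data.Nat.Combinatorics using (_C_)
open import Data.List using (List; []; _∷_)
open import Data.Vec using (Vec; toList)
open import Data.Maybe using (Maybe; just; nothing)
open import Data.Fin using (Fin)
open import Data.Product using (Σ; ∃)
open import Function.Bundles using (_↔_)
open import Relation.Binary.PropositionalEquality using (_≡_)

catalan : ℕ → ℕ
catalan i = ((2 * i) C i) / suc i

data Letter : Set where
  A  : Letter
  A̅ : Letter

complement : Letter → Letter
complement A  = A̅
complement A̅ = A

data PlaneTree : Set where
  node : List PlaneTree → PlaneTree

mutual
  edges : PlaneTree → ℕ
  edges (node cs) = edgesF cs

  edgesF : List PlaneTree → ℕ
  edgesF []       = 0
  edgesF (c ∷ cs) = suc (edges c + edgesF cs)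

-- Tracing the perimeter counterclockwise from the root: for each child c
-- (left to right) we traverse the edge down to c (one half edge), the
-- subtree of c, then the edge back up (the other half edge).  The function
-- reads the labels of the half edges in this order from the word, checks that
-- the two half edges of each edge carry complementary labels, and returns the
-- unread remainder of the word (nothing if the check fails / word too short).
eqLetter : Letter → Letter → Maybe Letter
eqLetter A  A  = just A
eqLetter A̅ A̅ = just A̅
eqLetter _  _  = nothing

mutual
  readF : List PlaneTree → List Letter → Maybe (List Letter)
  readF []            w = just w
  readF (node ds ∷ cs) []      = nothing
  readF (node ds ∷ cs) (a ∷ w) = afterChild a cs (readF ds w)

  afterChild : Letter → List PlaneTree → Maybe (List Letter) → Maybe (List Letter)
  afterChild a cs nothing        = nothing
  afterChild a cs (just [])      = nothing
  afterChild a cs (just (b ∷ w)) = closeEdge cs w (eqLetter b (complement a))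

  closeEdge : List PlaneTree → List Letter → Maybe Letter → Maybe (List Letter)
  closeEdge cs w nothing  = nothing
  closeEdge cs w (just _) = readF cs w

-- T is w-valid: labelling the i-th half edge by w[i], every edge has
-- complementary labels (and the word is used up exactly).
Valid : {n : ℕ} → Vec Letter (2 * n) → PlaneTree → Set
Valid w (node cs) = readF cs (toList w) ≡ just []

ValidTrees : (n : ℕ) → Vec Letter (2 * n) → Set
ValidTrees n w = Σ PlaneTree (λ T → Σ (edges T ≡ n) (λ _ → Valid {n} w T))

-- k ∈ R(n,1): some word of length 2n has exactly k valid plane trees
InR : ℕ → ℕ → Set
InR n k = ∃ λ (w : Vec Letter (2 * n)) → Fin k ↔ ValidTrees n w

module Submission where

-- Reading the half edges of a valid tree along the perimeter is a stack discipline: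
-- each letter either opens an edge or closes the innermost open one, which must carry
-- the complementary label.  Valid trees for w therefore correspond to such readings,
-- counted by a two-line recursion.  For the word A^(j+m) A̅^j A^j (AA̅)^ℓ A̅^(j+m) of
-- length 2(2j+ℓ+m), the letters A̅^j may close any number s ≤ j of the first A's (an A
-- opened above an unclosed A̅ could never be closed later), giving the factor j + 1;
-- the block (AA̅)^ℓ is then read in C(2ℓ,ℓ) − C(2ℓ,ℓ+1) = C_ℓ ways (a ballot count), and
-- A̅^(j+m) closes the rest.

open import Axiom.UniquenessOfIdentityProofs.WithK using (uip)
open import Data.Empty using (⊥; ⊥-elim)
open import Data.Fin using (Fin; zero)
open import Data.Fin.Properties using (+↔⊎)
open import Data.List using (List; []; _∷_; _++_; length; replicate)
open import Data.List.Properties using (length-replicate; ++-identityʳ)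
open import Data.Maybe using (Maybe; just)
open import Data.Nat using (ℕ; zero; suc; _+_; _*_; _∸_; _/_; _≤_; s≤s)
open import Data.Nat.Combinatorics using (_C_; nCk+nC[k+1]≡[n+1]C[k+1]; nCk≡nC[n∸k]; nC1≡n)
open import Data.Nat.DivMod using (m*n/n≡m)
open import Data.Nat.Properties
open import Data.Nat.Tactic.RingSolver using (solve-∀)
open import Data.Product using (Σ; _×_; _,_; proj₂)
open import Data.Sum using (_⊎_; inj₁; inj₂)
open import Data.Sum.Function.Propositional using (_⊎-↔_)
open import Data.Unit using (⊤; tt)
open import Data.Vec using (Vec; toList; fromList; cast)
open import Data.Vec.Properties using (length-toList; toList-cast; toList∘fromList)
open import Defs
open import Function.Bundles using (_↔_; mk↔ₛ′)
open import Function.Construct.Composition using (_↔-∘_)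
open import Function.Construct.Symmetry using (↔-sym)
open import Relation.Binary.PropositionalEquality
open import Relation.Nullary using (¬_)

open ≡-Reasoning

C-pascal : ∀ n k → suc n C suc k ≡ n C k + n C suc k
C-pascal n k = sym (nCk+nC[k+1]≡[n+1]C[k+1] n k)

C-pascal² : ∀ n k →
  suc (suc n) C suc (suc k) ≡ n C k + (n C suc k + n C suc k) + n C suc (suc k)
C-pascal² n k = begin
  suc (suc n) C suc (suc k)                            ≡⟨ C-pascal (suc n) (suc k) ⟩
  suc n C suc k + suc n C suc (suc k)                  ≡⟨ cong₂ _+_ (C-pascal n k) (C-pascal n (suc k)) ⟩
  (n C k + n C suc k) + (n C suc k + n C suc (suc k))  ≡⟨ regroup (n C k) (n C suc k) (n C suc (suc k)) ⟩
  n C k + (n C suc k + n C suc k) + n C suc (suc k)    ∎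
  where
  regroup : ∀ a b c → (a + b) + (b + c) ≡ a + (b + b) + c
  regroup = solve-∀

C-absorb : ∀ n k → suc k * (suc n C suc k) ≡ suc n * (n C k)
C-absorb zero    zero    = refl
C-absorb zero    (suc k) = *-zeroʳ (suc (suc k))
C-absorb (suc n) zero    = begin
  1 * (suc (suc n) C 1) ≡⟨ *-identityˡ _ ⟩
  suc (suc n) C 1       ≡⟨ nC1≡n (suc (suc n)) ⟩
  suc (suc n)           ≡⟨ *-identityʳ (suc (suc n)) ⟨
  suc (suc n) * 1       ∎
C-absorb (suc n) (suc k) = begin
  suc (suc k) * (suc (suc n) C suc (suc k)) ≡⟨ cong (suc (suc k) *_) (C-pascal (suc n) (suc k)) ⟩
  suc (suc k) * (x + y)                     ≡⟨ split k x y ⟩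
  x + suc k * x + suc (suc k) * y           ≡⟨ cong₂ _+_ (cong (x +_) (C-absorb n k)) (C-absorb n (suc k)) ⟩
  x + suc n * (n C k) + suc n * (n C suc k) ≡⟨ merge n x (n C k) (n C suc k) ⟩
  x + suc n * (n C k + n C suc k)           ≡⟨ cong (λ z → x + suc n * z) (C-pascal n k) ⟨
  suc (suc n) * x                           ∎
  where
  x = suc n C suc k
  y = suc n C suc (suc k)
  split : ∀ k x y → suc (suc k) * (x + y) ≡ x + suc k * x + suc (suc k) * y
  split = solve-∀
  merge : ∀ n x a b → x + suc n * a + suc n * b ≡ x + suc n * (a + b)
  merge = solve-∀

C-central-absorb : ∀ ℓ → suc ℓ * ((2 * ℓ) C suc ℓ) ≡ ℓ * ((2 * ℓ) C ℓ)
C-central-absorb ℓ = +-cancelˡ-≡ (suc ℓ * x) _ _ (begin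
  suc ℓ * x + suc ℓ * y         ≡⟨ *-distribˡ-+ (suc ℓ) x y ⟨
  suc ℓ * (x + y)               ≡⟨ cong (suc ℓ *_) (C-pascal (2 * ℓ) ℓ) ⟨
  suc ℓ * (suc (2 * ℓ) C suc ℓ) ≡⟨ C-absorb (2 * ℓ) ℓ ⟩
  suc (2 * ℓ) * x               ≡⟨ split ℓ x ⟩
  suc ℓ * x + ℓ * x             ∎)
  where
  x = (2 * ℓ) C ℓ
  y = (2 * ℓ) C suc ℓ
  split : ∀ ℓ x → suc (2 * ℓ) * x ≡ suc ℓ * x + ℓ * x
  split = solve-∀

C-central-sym : ∀ ℓ → (2 * suc ℓ) C suc (suc ℓ) ≡ (2 * suc ℓ) C ℓ
C-central-sym ℓ = trans (nCk≡nC[n∸k] ℓ+2≤2ℓ+2) (cong ((2 * suc ℓ) C_) 2ℓ+2∸[ℓ+2]≡ℓ)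
  where
  ℓ+2≤2ℓ+2 : suc (suc ℓ) ≤ 2 * suc ℓ
  ℓ+2≤2ℓ+2 = ≤-trans (s≤s (s≤s (m≤m+n ℓ (ℓ + 0)))) (≤-reflexive (sym (*-suc 2 ℓ)))
  2ℓ+2∸[ℓ+2]≡ℓ : 2 * suc ℓ ∸ suc (suc ℓ) ≡ ℓ
  2ℓ+2∸[ℓ+2]≡ℓ = begin
    2 * suc ℓ ∸ suc (suc ℓ) ≡⟨ cong (_∸ suc (suc ℓ)) (*-suc 2 ℓ) ⟩
    (ℓ + (ℓ + 0)) ∸ ℓ       ≡⟨ m+n∸m≡n ℓ (ℓ + 0) ⟩
    ℓ + 0                   ≡⟨ +-identityʳ ℓ ⟩
    ℓ                       ∎

ballot : ℕ → ℕ → ℕ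
ballot zero    zero    = 1
ballot zero    (suc g) = 0
ballot (suc ℓ) zero    = ballot ℓ 1 + ballot ℓ 0
ballot (suc ℓ) (suc g) = (ballot ℓ (suc (suc g)) + ballot ℓ (suc g)) + (ballot ℓ (suc g) + ballot ℓ g)

ballot-step : ∀ N k b₀ b₁ b₂ →
  b₂ + N C suc (suc (suc k)) ≡ N C suc (suc k) →
  b₁ + N C suc (suc k) ≡ N C suc k →
  b₀ + N C suc k ≡ N C k →
  ((b₂ + b₁) + (b₁ + b₀)) + suc (suc N) C suc (suc (suc k)) ≡ suc (suc N) C suc (suc k)
ballot-step N k b₀ b₁ b₂ e₂ e₁ e₀ = begin
  ((b₂ + b₁) + (b₁ + b₀)) + suc (suc N) C suc (suc (suc k))
    ≡⟨ cong (((b₂ + b₁) + (b₁ + b₀)) +_) (C-pascal² N (suc k)) ⟩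
  ((b₂ + b₁) + (b₁ + b₀)) + (c₁ + (c₂ + c₂) + c₃)
    ≡⟨ regroup b₀ b₁ b₂ c₁ c₂ c₃ ⟩
  (b₀ + c₁) + ((b₁ + c₂) + (b₁ + c₂)) + (b₂ + c₃)
    ≡⟨ cong₂ _+_ (cong₂ _+_ e₀ (cong₂ _+_ e₁ e₁)) e₂ ⟩
  N C k + (c₁ + c₁) + c₂
    ≡⟨ C-pascal² N k ⟨
  suc (suc N) C suc (suc k) ∎
  where
  c₁ = N C suc k
  c₂ = N C suc (suc k)
  c₃ = N C suc (suc (suc k))
  regroup : ∀ b₀ b₁ b₂ c₁ c₂ c₃ → ((b₂ + b₁) + (b₁ + b₀)) + (c₁ + (c₂ + c₂) + c₃)
                                   ≡ (b₀ + c₁) + ((b₁ + c₂) + (b₁ + c₂)) + (b₂ + c₃)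
  regroup = solve-∀

-- The case g = 0 of ballot-closedForm: the recurrence lacks the term for g − 1, and
-- the symmetry of the even row N = 2(k + 1) makes up for it.
ballot-step₀ : ∀ N k b₀ b₁ →
  b₁ + N C suc (suc (suc k)) ≡ N C suc (suc k) →
  b₀ + N C suc (suc k) ≡ N C suc k →
  N C suc (suc k) ≡ N C k →
  (b₁ + b₀) + suc (suc N) C suc (suc (suc k)) ≡ suc (suc N) C suc (suc k)
ballot-step₀ N k b₀ b₁ e₁ e₀ sym-N = begin
  (b₁ + b₀) + suc (suc N) C suc (suc (suc k))
    ≡⟨ cong ((b₁ + b₀) +_) (C-pascal² N (suc k)) ⟩
  (b₁ + b₀) + (c₁ + (c₂ + c₂) + c₃)
    ≡⟨ regroup b₀ b₁ c₁ c₂ c₃ ⟩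
  (b₁ + c₃) + (b₀ + c₂) + c₁ + c₂
    ≡⟨ cong (λ z → z + c₁ + c₂) (cong₂ _+_ e₁ e₀) ⟩
  c₂ + c₁ + c₁ + c₂
    ≡⟨ cong (λ z → z + c₁ + c₁ + c₂) sym-N ⟩
  N C k + c₁ + c₁ + c₂
    ≡⟨ cong (_+ c₂) (+-assoc (N C k) c₁ c₁) ⟩
  N C k + (c₁ + c₁) + c₂
    ≡⟨ C-pascal² N k ⟨
  suc (suc N) C suc (suc k) ∎
  where
  c₁ = N C suc k
  c₂ = N C suc (suc k)
  c₃ = N C suc (suc (suc k))
  regroup : ∀ b₀ b₁ c₁ c₂ c₃ → (b₁ + b₀) + (c₁ + (c₂ + c₂) + c₃) ≡ (b₁ + c₃) + (b₀ + c₂) + c₁ + c₂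
  regroup = solve-∀

ballot-closedForm : ∀ ℓ g → ballot ℓ g + (2 * ℓ) C suc (g + ℓ) ≡ (2 * ℓ) C (g + ℓ)
ballot-closedForm zero          zero    = refl
ballot-closedForm zero          (suc g) = refl
ballot-closedForm (suc zero)    zero    = refl
ballot-closedForm (suc (suc ℓ)) zero    =
  subst (λ N → ballot (suc (suc ℓ)) 0 + N C suc (suc (suc ℓ)) ≡ N C suc (suc ℓ))
    (sym (*-suc 2 (suc ℓ)))
    (ballot-step₀ (2 * suc ℓ) ℓ _ _
      (ballot-closedForm (suc ℓ) 1) (ballot-closedForm (suc ℓ) 0) (C-central-sym ℓ))
ballot-closedForm (suc ℓ)       (suc g) =
  subst₂ (λ N k → ballot (suc ℓ) (suc g) + N C suc k ≡ N C k)
    (sym (*-suc 2 ℓ)) (cong suc (sym (+-suc g ℓ)))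
    (ballot-step (2 * ℓ) (g + ℓ) _ _ _
      (ballot-closedForm ℓ (suc (suc g))) (ballot-closedForm ℓ (suc g)) (ballot-closedForm ℓ g))

ballot≡catalan : ∀ ℓ → ballot ℓ 0 ≡ catalan ℓ
ballot≡catalan ℓ = sym (begin
  x / suc ℓ             ≡⟨ cong (_/ suc ℓ) x≡b*[1+ℓ] ⟩
  b * suc ℓ / suc ℓ     ≡⟨ m*n/n≡m b (suc ℓ) ⟩
  b                     ∎)
  where
  b = ballot ℓ 0
  x = (2 * ℓ) C ℓ
  y = (2 * ℓ) C suc ℓ
  [1+ℓ]*b+[1+ℓ]*y≡x+[1+ℓ]*y : suc ℓ * b + suc ℓ * y ≡ x + suc ℓ * y
  [1+ℓ]*b+[1+ℓ]*y≡x+[1+ℓ]*y = begin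
    suc ℓ * b + suc ℓ * y ≡⟨ *-distribˡ-+ (suc ℓ) b y ⟨
    suc ℓ * (b + y)       ≡⟨ cong (suc ℓ *_) (ballot-closedForm ℓ 0) ⟩
    suc ℓ * x             ≡⟨⟩
    x + ℓ * x             ≡⟨ cong (x +_) (C-central-absorb ℓ) ⟨
    x + suc ℓ * y         ∎
  x≡b*[1+ℓ] : x ≡ b * suc ℓ
  x≡b*[1+ℓ] = sym (trans (*-comm b (suc ℓ)) (+-cancelʳ-≡ (suc ℓ * y) _ _ [1+ℓ]*b+[1+ℓ]*y≡x+[1+ℓ]*y))

-- st is the stack of labels of the edges still open, innermost first.
mutual
  readings : List Letter → List Letter → ℕ
  readings []      []      = 1
  readings []      (_ ∷ _) = 0
  readings (a ∷ w) st      = readings w (a ∷ st) + closings a w st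

  closings : Letter → List Letter → List Letter → ℕ
  closings a  w []         = 0
  closings A  w (A  ∷ st)  = 0
  closings A  w (A̅ ∷ st) = readings w st
  closings A̅ w (A  ∷ st)  = readings w st
  closings A̅ w (A̅ ∷ st) = 0

-- A reading of w under st: a forest read off a prefix of w, after which the rest
-- of w closes the open edges of st one at a time, each closing followed by a forest.
mutual
  Reading : List Letter → List Letter → Set
  Reading w st = Σ (List PlaneTree) λ cs → Σ (List Letter) λ r → readF cs w ≡ just r × Closes r st

  Closes : List Letter → List Letter → Set
  Closes []      []       = ⊤
  Closes (_ ∷ _) []       = ⊥
  Closes []      (_ ∷ _)  = ⊥
  Closes (b ∷ r) (s ∷ st) = b ≡ complement s × Reading r st

AfterChild : Letter → List PlaneTree → Maybe (List Letter) → List Letter → Set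
AfterChild a cs m r = Σ (List Letter) λ w → m ≡ just (complement a ∷ w) × readF cs w ≡ just r

eqLetter≡just⇒≡ : ∀ b c {x} → eqLetter b c ≡ just x → b ≡ c
eqLetter≡just⇒≡ A  A  _ = refl
eqLetter≡just⇒≡ A̅ A̅ _ = refl

eqLetter-refl : ∀ a → eqLetter a a ≡ just a
eqLetter-refl A  = refl
eqLetter-refl A̅ = refl

afterChild≡just⇒ : ∀ a cs m {r} → afterChild a cs m ≡ just r → AfterChild a cs m r
afterChild≡just⇒ a cs (just (b ∷ w)) e with eqLetter b (complement a) in b≡a̅
... | just _ = w , cong (λ b → just (b ∷ w)) (eqLetter≡just⇒≡ b (complement a) b≡a̅) , e

afterChild≡just⇐ : ∀ a cs m {r} → AfterChild a cs m r → afterChild a cs m ≡ just r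
afterChild≡just⇐ a cs _ (w , refl , e) rewrite eqLetter-refl (complement a) = e

AfterChild-irrelevant : ∀ a cs m r (x y : AfterChild a cs m r) → x ≡ y
AfterChild-irrelevant a cs _ r (w , refl , e) (.w , refl , e′) = cong (λ e → w , refl , e) (uip e e′)

module _ (a : Letter) (w st : List Letter) where

  private
    opened : ∀ ds cs r → Closes r st → AfterChild a cs (readF ds w) r →
             Reading w (a ∷ st) ⊎ Closes (a ∷ w) st
    opened ds cs r closes (w′ , e₁ , e₂) = inj₁ (ds , complement a ∷ w′ , e₁ , refl , cs , r , e₂ , closes)

    to : Reading (a ∷ w) st → Reading w (a ∷ st) ⊎ Closes (a ∷ w) st
    to ([]             , _ , refl , closes) = inj₂ closes
    to (node ds ∷ cs , r , e    , closes) = opened ds cs r closes (afterChild≡just⇒ a cs (readF ds w) e)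

    from : Reading w (a ∷ st) ⊎ Closes (a ∷ w) st → Reading (a ∷ w) st
    from (inj₁ (ds , b ∷ w′ , e₁ , refl , cs , r , e₂ , closes)) =
      node ds ∷ cs , r , afterChild≡just⇐ a cs (readF ds w) (w′ , e₁ , e₂) , closes
    from (inj₂ closes) = [] , a ∷ w , refl , closes

    to∘from : ∀ y → to (from y) ≡ y
    to∘from (inj₁ (ds , b ∷ w′ , e₁ , refl , cs , r , e₂ , closes)) =
      cong (opened ds cs r closes) (AfterChild-irrelevant a cs (readF ds w) r _ _)
    to∘from (inj₂ closes) = refl

    from∘to : ∀ x → from (to x) ≡ x
    from∘to ([]             , _ , refl , closes) = refl
    from∘to (node ds ∷ cs , r , e    , closes) = cong (λ e → node ds ∷ cs , r , e , closes) (uip _ _)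

  Reading-∷-↔ : Reading (a ∷ w) st ↔ (Reading w (a ∷ st) ⊎ Closes (a ∷ w) st)
  Reading-∷-↔ = mk↔ₛ′ to from to∘from from∘to

Fin0↔ : {X : Set} → ¬ X → Fin 0 ↔ X
Fin0↔ ¬x = mk↔ₛ′ (λ ()) (λ x → ⊥-elim (¬x x)) (λ x → ⊥-elim (¬x x)) (λ ())

Fin1↔Reading[][] : Fin 1 ↔ Reading [] []
Fin1↔Reading[][] = mk↔ₛ′ (λ _ → [] , [] , refl , tt) (λ _ → zero) unique (λ { zero → refl })
  where
  unique : (x : Reading [] []) → ([] , [] , refl , tt) ≡ x
  unique ([]          , _ , refl , tt) = refl
  unique (node _ ∷ _ , _ , ()   , _)

¬Reading[]∷ : ∀ s st → ¬ Reading [] (s ∷ st)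
¬Reading[]∷ s st ([]          , _ , refl , ())
¬Reading[]∷ s st (node _ ∷ _ , _ , ()   , _)

refl×↔ : {X Y : Set} (y : Y) → X ↔ (y ≡ y × X)
refl×↔ y = mk↔ₛ′ (refl ,_) proj₂ (λ { (refl , _) → refl }) (λ _ → refl)

closings-↔ : ∀ a w st → (∀ st → Fin (readings w st) ↔ Reading w st) →
             Fin (closings a w st) ↔ Closes (a ∷ w) st
closings-↔ a  w []        _ = Fin0↔ λ ()
closings-↔ A  w (A  ∷ st) _ = Fin0↔ λ ()
closings-↔ A  w (A̅ ∷ st) ↔w = refl×↔ A ↔-∘ ↔w st
closings-↔ A̅ w (A  ∷ st) ↔w = refl×↔ A̅ ↔-∘ ↔w st
closings-↔ A̅ w (A̅ ∷ st) _ = Fin0↔ λ ()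

readings-↔ : ∀ w st → Fin (readings w st) ↔ Reading w st
readings-↔ []      []       = Fin1↔Reading[][]
readings-↔ []      (s ∷ st) = Fin0↔ (¬Reading[]∷ s st)
readings-↔ (a ∷ w) st       =
  ↔-sym (Reading-∷-↔ a w st) ↔-∘ ((readings-↔ w (a ∷ st) ⊎-↔ closings-↔ a w st (readings-↔ w)) ↔-∘ +↔⊎)

readF-length : ∀ cs w {r} → readF cs w ≡ just r → length w ≡ edgesF cs + edgesF cs + length r
readF-length []             w       refl = refl
readF-length (node ds ∷ cs) (a ∷ w) {r} e with afterChild≡just⇒ a cs (readF ds w) e
... | w′ , e₁ , e₂ = begin
  suc (length w)
    ≡⟨ cong suc (readF-length ds w e₁) ⟩
  suc (edgesF ds + edgesF ds + suc (length w′))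
    ≡⟨ cong (λ n → suc (edgesF ds + edgesF ds + suc n)) (readF-length cs w′ e₂) ⟩
  suc (edgesF ds + edgesF ds + suc (edgesF cs + edgesF cs + length r))
    ≡⟨ regroup (edgesF ds) (edgesF cs) (length r) ⟩
  suc (edgesF ds + edgesF cs) + suc (edgesF ds + edgesF cs) + length r ∎
  where
  regroup : ∀ d c x → suc (d + d + suc (c + c + x)) ≡ suc (d + c) + suc (d + c) + x
  regroup = solve-∀

Valid⇒edges≡ : ∀ n (w : Vec Letter (2 * n)) cs → readF cs (toList w) ≡ just [] → edgesF cs ≡ n
Valid⇒edges≡ n w cs valid = *-cancelˡ-≡ (edgesF cs) n 2 (begin
  2 * edgesF cs                   ≡⟨ double (edgesF cs) ⟩
  edgesF cs + edgesF cs + 0       ≡⟨ readF-length cs (toList w) valid ⟨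
  length (toList w)               ≡⟨ length-toList w ⟩
  2 * n                           ∎)
  where
  double : ∀ e → 2 * e ≡ e + e + 0
  double = solve-∀

ValidTrees↔Reading : ∀ n (w : Vec Letter (2 * n)) → ValidTrees n w ↔ Reading (toList w) []
ValidTrees↔Reading n w = mk↔ₛ′ to from to∘from from∘to
  where
  to : ValidTrees n w → Reading (toList w) []
  to (node cs , _ , valid) = cs , [] , valid , tt
  from : Reading (toList w) [] → ValidTrees n w
  from (cs , [] , valid , tt) = node cs , Valid⇒edges≡ n w cs valid , valid
  to∘from : ∀ x → to (from x) ≡ x
  to∘from (cs , [] , valid , tt) = refl
  from∘to : ∀ x → from (to x) ≡ x
  from∘to (node cs , e , valid) = cong (λ e → node cs , e , valid) (≡-irrelevant _ _)

replicate-++ : ∀ {X : Set} a b (x : X) → replicate a x ++ replicate b x ≡ replicate (a + b) x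
replicate-++ zero    b x = refl
replicate-++ (suc a) b x = cong (x ∷_) (replicate-++ a b x)

replicate-++-∷ : ∀ {X : Set} k (x : X) xs → replicate k x ++ x ∷ xs ≡ x ∷ replicate k x ++ xs
replicate-++-∷ zero    x xs = refl
replicate-++-∷ (suc k) x xs = cong (x ∷_) (replicate-++-∷ k x xs)

A^ A̅^ : ℕ → List Letter
A^  k = replicate k A
A̅^ k = replicate k A̅

[AA̅]^ [A̅A]^ : ℕ → List Letter
[AA̅]^ zero    = []
[AA̅]^ (suc ℓ) = A ∷ A̅ ∷ [AA̅]^ ℓ
[A̅A]^ zero    = []
[A̅A]^ (suc g) = A̅ ∷ A ∷ [A̅A]^ g

TopNotA̅ : List Letter → Set
TopNotA̅ (A̅ ∷ _) = ⊥
TopNotA̅ _        = ⊤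

A^-TopNotA̅ : ∀ k → TopNotA̅ (A^ k)
A^-TopNotA̅ zero    = tt
A^-TopNotA̅ (suc k) = tt

closings-A : ∀ w st → TopNotA̅ st → closings A w st ≡ 0
closings-A w []      _ = refl
closings-A w (A ∷ _) _ = refl

readings-A̅^-A̅∷ : ∀ k st → readings (A̅^ k) (A̅ ∷ st) ≡ 0
readings-A̅^-A̅∷ zero    st = refl
readings-A̅^-A̅∷ (suc k) st = cong (_+ 0) (readings-A̅^-A̅∷ k (A̅ ∷ st))

readings-A̅^-A^ : ∀ k → readings (A̅^ k) (A^ k) ≡ 1
readings-A̅^-A^ zero    = refl
readings-A̅^-A^ (suc k) = cong₂ _+_ (readings-A̅^-A̅∷ k (A ∷ A^ k)) (readings-A̅^-A^ k)

readings-A̅^-A^++A̅∷ : ∀ k a st → readings (A̅^ k) (A^ a ++ A̅ ∷ st) ≡ 0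
readings-A̅^-A^++A̅∷ zero    zero    st = refl
readings-A̅^-A^++A̅∷ zero    (suc a) st = refl
readings-A̅^-A^++A̅∷ (suc k) zero    st = readings-A̅^-A̅∷ (suc k) st
readings-A̅^-A^++A̅∷ (suc k) (suc a) st =
  cong₂ _+_ (readings-A̅^-A̅∷ k _) (readings-A̅^-A^++A̅∷ k a st)

readings-[AA̅]^ : ∀ K ℓ g st → TopNotA̅ st →
  readings ([AA̅]^ ℓ ++ A̅^ K) ([A̅A]^ g ++ st) ≡ ballot ℓ g * readings (A̅^ K) st
readings-[AA̅]^ K zero    zero    st _   = sym (+-identityʳ _)
readings-[AA̅]^ K zero    (suc g) st _   = readings-A̅^-A̅∷ K _
readings-[AA̅]^ K (suc ℓ) zero    st top = begin
  readings w (A̅ ∷ A ∷ st) + readings w st + closings A (A̅ ∷ w) st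
    ≡⟨ cong₂ _+_ (cong₂ _+_ (readings-[AA̅]^ K ℓ 1 st top) (readings-[AA̅]^ K ℓ 0 st top))
                 (closings-A (A̅ ∷ w) st top) ⟩
  ballot ℓ 1 * x + ballot ℓ 0 * x + 0
    ≡⟨ distrib (ballot ℓ 1) (ballot ℓ 0) x ⟩
  (ballot ℓ 1 + ballot ℓ 0) * x ∎
  where
  w = [AA̅]^ ℓ ++ A̅^ K
  x = readings (A̅^ K) st
  distrib : ∀ a b x → a * x + b * x + 0 ≡ (a + b) * x
  distrib = solve-∀
readings-[AA̅]^ K (suc ℓ) (suc g) st top =
  trans (cong₂ _+_ (cong₂ _+_ (IH (suc (suc g))) (IH (suc g))) (cong₂ _+_ (IH (suc g)) (IH g)))
        (distrib (ballot ℓ (suc (suc g))) (ballot ℓ (suc g)) (ballot ℓ g) _)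
  where
  IH : ∀ g → readings ([AA̅]^ ℓ ++ A̅^ K) ([A̅A]^ g ++ st) ≡ ballot ℓ g * readings (A̅^ K) st
  IH g = readings-[AA̅]^ K ℓ g st top
  distrib : ∀ a b c x → (a * x + b * x) + (b * x + c * x) ≡ ((a + b) + (b + c)) * x
  distrib = solve-∀

readings-A^++ : ∀ k w st → TopNotA̅ st → readings (A^ k ++ w) st ≡ readings w (A^ k ++ st)
readings-A^++ zero    w st _   = refl
readings-A^++ (suc k) w st top = begin
  readings (A^ k ++ w) (A ∷ st) + closings A (A^ k ++ w) st
    ≡⟨ cong₂ _+_ (readings-A^++ k w (A ∷ st) tt) (closings-A _ st top) ⟩
  readings w (A^ k ++ A ∷ st) + 0
    ≡⟨ +-identityʳ _ ⟩
  readings w (A^ k ++ A ∷ st)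
    ≡⟨ cong (readings w) (replicate-++-∷ k A st) ⟩
  readings w (A ∷ A^ k ++ st) ∎

readings-A̅^++ : ∀ k w st → readings (A̅^ k ++ w) (A̅ ∷ st) ≡ readings w (A̅^ (suc k) ++ st)
readings-A̅^++ zero    w st = refl
readings-A̅^++ (suc k) w st = begin
  readings (A̅^ k ++ w) (A̅ ∷ A̅ ∷ st) + 0 ≡⟨ +-identityʳ _ ⟩
  readings (A̅^ k ++ w) (A̅ ∷ A̅ ∷ st)     ≡⟨ readings-A̅^++ k w (A̅ ∷ st) ⟩
  readings w (A̅ ∷ A̅^ k ++ A̅ ∷ st)       ≡⟨ cong (λ s → readings w (A̅ ∷ s)) (replicate-++-∷ k A̅ st) ⟩
  readings w (A̅ ∷ A̅ ∷ A̅^ k ++ st)       ∎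

suffix : ℕ → ℕ → List Letter
suffix K ℓ = [AA̅]^ ℓ ++ A̅^ K

-- An A opened on top of an open A̅ buries it: the A̅s of the suffix can never close it.
readings-A^-A̅^ : ∀ K ℓ b d c →
  readings (A^ (b + d) ++ suffix K ℓ) (A̅^ b ++ A^ c) ≡ readings (suffix K ℓ) (A^ (d + c))
readings-A^-A̅^ K ℓ zero    d c = begin
  readings (A^ d ++ suffix K ℓ) (A^ c) ≡⟨ readings-A^++ d (suffix K ℓ) (A^ c) (A^-TopNotA̅ c) ⟩
  readings (suffix K ℓ) (A^ d ++ A^ c) ≡⟨ cong (readings (suffix K ℓ)) (replicate-++ d c A) ⟩
  readings (suffix K ℓ) (A^ (d + c))   ∎
readings-A^-A̅^ K ℓ (suc b) d c = cong₂ _+_ buried (readings-A^-A̅^ K ℓ b d c)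
  where
  buried : readings (A^ (b + d) ++ suffix K ℓ) (A ∷ A̅ ∷ A̅^ b ++ A^ c) ≡ 0
  buried = begin
    readings (A^ (b + d) ++ suffix K ℓ) (A ∷ A̅ ∷ A̅^ b ++ A^ c)
      ≡⟨ readings-A^++ (b + d) _ _ tt ⟩
    readings (suffix K ℓ) (A^ (b + d) ++ A ∷ A̅ ∷ A̅^ b ++ A^ c)
      ≡⟨ cong (readings (suffix K ℓ)) (replicate-++-∷ (b + d) A _) ⟩
    readings (suffix K ℓ) (A^ (suc (b + d)) ++ A̅ ∷ A̅^ b ++ A^ c)
      ≡⟨ readings-[AA̅]^ K ℓ 0 _ tt ⟩
    ballot ℓ 0 * readings (A̅^ K) (A^ (suc (b + d)) ++ A̅ ∷ A̅^ b ++ A^ c)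
      ≡⟨ cong (ballot ℓ 0 *_) (readings-A̅^-A^++A̅∷ K (suc (b + d)) _) ⟩
    ballot ℓ 0 * 0
      ≡⟨ *-zeroʳ (ballot ℓ 0) ⟩
    0 ∎

-- The A̅s close the top s ≤ i open A-edges and open i ∸ s new ones; the following
-- As must first close those, after which every choice of s leaves the same stack.
readings-A̅^-A^-suffix : ∀ K ℓ i d e →
  readings (A̅^ i ++ A^ (i + d) ++ suffix K ℓ) (A^ (i + e))
    ≡ suc i * readings (suffix K ℓ) (A^ (d + (i + e)))
readings-A̅^-A^-suffix K ℓ zero    d e = trans (readings-A^-A̅^ K ℓ 0 d e) (sym (+-identityʳ _))
readings-A̅^-A^-suffix K ℓ (suc i) d e = begin
  readings (A̅^ i ++ A^ (suc i + d) ++ suffix K ℓ) (A̅ ∷ A^ (suc i + e))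
    + readings (A̅^ i ++ A^ (suc i + d) ++ suffix K ℓ) (A^ (i + e))
    ≡⟨ cong₂ _+_ open-A̅ close-A ⟩
  readings (suffix K ℓ) (A^ (d + suc (i + e)))
    + suc i * readings (suffix K ℓ) (A^ (suc d + (i + e)))
    ≡⟨ cong (λ k → readings (suffix K ℓ) (A^ (d + suc (i + e))) + suc i * readings (suffix K ℓ) (A^ k))
            (+-suc d (i + e)) ⟨
  suc (suc i) * readings (suffix K ℓ) (A^ (d + suc (i + e))) ∎
  where
  open-A̅ : readings (A̅^ i ++ A^ (suc i + d) ++ suffix K ℓ) (A̅ ∷ A^ (suc i + e))
             ≡ readings (suffix K ℓ) (A^ (d + suc (i + e)))
  open-A̅ = trans (readings-A̅^++ i _ _) (readings-A^-A̅^ K ℓ (suc i) d (suc i + e))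
  close-A : readings (A̅^ i ++ A^ (suc i + d) ++ suffix K ℓ) (A^ (i + e))
              ≡ suc i * readings (suffix K ℓ) (A^ (suc d + (i + e)))
  close-A = subst (λ k → readings (A̅^ i ++ A^ k ++ suffix K ℓ) (A^ (i + e))
                           ≡ suc i * readings (suffix K ℓ) (A^ (suc d + (i + e))))
                  (+-suc i d) (readings-A̅^-A^-suffix K ℓ i (suc d) e)

word : ℕ → ℕ → ℕ → List Letter
word j m ℓ = A^ (j + m) ++ A̅^ j ++ A^ j ++ suffix (j + m) ℓ

readings-word : ∀ j m ℓ → readings (word j m ℓ) [] ≡ suc j * catalan ℓ
readings-word j m ℓ = begin
  readings (word j m ℓ) []
    ≡⟨ readings-A^++ (j + m) _ [] tt ⟩
  readings (A̅^ j ++ A^ j ++ suffix K ℓ) (A^ (j + m) ++ [])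
    ≡⟨ cong₂ (λ k st → readings (A̅^ j ++ A^ k ++ suffix K ℓ) st) (sym (+-identityʳ j)) (++-identityʳ _) ⟩
  readings (A̅^ j ++ A^ (j + 0) ++ suffix K ℓ) (A^ (j + m))
    ≡⟨ readings-A̅^-A^-suffix K ℓ j 0 m ⟩
  suc j * readings (suffix K ℓ) (A^ K)
    ≡⟨ cong (suc j *_) (readings-[AA̅]^ K ℓ 0 (A^ K) (A^-TopNotA̅ K)) ⟩
  suc j * (ballot ℓ 0 * readings (A̅^ K) (A^ K))
    ≡⟨ cong (λ x → suc j * (ballot ℓ 0 * x)) (readings-A̅^-A^ K) ⟩
  suc j * (ballot ℓ 0 * 1)
    ≡⟨ cong (suc j *_) (trans (*-identityʳ _) (ballot≡catalan ℓ)) ⟩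
  suc j * catalan ℓ ∎
  where
  K = j + m

length-replicate-++ : ∀ {X : Set} k (x : X) xs → length (replicate k x ++ xs) ≡ k + length xs
length-replicate-++ zero    x xs = refl
length-replicate-++ (suc k) x xs = cong suc (length-replicate-++ k x xs)

length-suffix : ∀ K ℓ → length (suffix K ℓ) ≡ ℓ + ℓ + K
length-suffix K zero    = length-replicate K
length-suffix K (suc ℓ) = cong suc (trans (cong suc (length-suffix K ℓ)) (sym (cong (_+ K) (+-suc ℓ ℓ))))

length-word : ∀ j m ℓ → length (word j m ℓ) ≡ 2 * (2 * j + ℓ + m)
length-word j m ℓ = begin
  length (word j m ℓ)                                ≡⟨ length-replicate-++ (j + m) A _ ⟩
  j + m + length (A̅^ j ++ A^ j ++ suffix (j + m) ℓ) ≡⟨ cong (j + m +_) (length-replicate-++ j A̅ _) ⟩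
  j + m + (j + length (A^ j ++ suffix (j + m) ℓ))    ≡⟨ cong (λ x → j + m + (j + x)) (length-replicate-++ j A _) ⟩
  j + m + (j + (j + length (suffix (j + m) ℓ)))      ≡⟨ cong (λ x → j + m + (j + (j + x))) (length-suffix (j + m) ℓ) ⟩
  j + m + (j + (j + (ℓ + ℓ + (j + m))))              ≡⟨ regroup j m ℓ ⟩
  2 * (2 * j + ℓ + m)                                ∎
  where
  regroup : ∀ j m ℓ → j + m + (j + (j + (ℓ + ℓ + (j + m)))) ≡ 2 * (2 * j + ℓ + m)
  regroup = solve-∀

InR-readings : ∀ n (w : List Letter) → length w ≡ 2 * n → InR n (readings w [])
InR-readings n w |w|≡2n = v , ↔-sym (ValidTrees↔Reading n v) ↔-∘ Fin↔Reading-v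
  where
  v : Vec Letter (2 * n)
  v = cast |w|≡2n (fromList w)
  toList-v : toList v ≡ w
  toList-v = trans (toList-cast |w|≡2n (fromList w)) (toList∘fromList w)
  Fin↔Reading-v : Fin (readings w []) ↔ Reading (toList v) []
  Fin↔Reading-v = subst (λ u → Fin (readings w []) ↔ Reading u []) (sym toList-v) (readings-↔ w [])

mainTheorem13 : (n : ℕ) → 1 ≤ n → (j ℓ : ℕ) → 2 * j + ℓ ≤ n →
    InR n (suc j * catalan ℓ)
mainTheorem13 n _ j ℓ 2j+ℓ≤n with m≤n⇒∃[o]m+o≡n 2j+ℓ≤n
... | m , refl = subst (InR n) (readings-word j m ℓ) (InR-readings n (word j m ℓ) (length-word j m ℓ))
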